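{- Let $l \geq 2$ and $n$ a positive integer. If the de Bruijn graph $G_l$ contains a balanced circuit of length $n$, then $G_{l+1}$ contains a balanced cycle of length $n$.
   Context: For $l \geq 2$, the de Bruijn graph $G_l$ is the directed graph (loops allowed) with vertex set $\{0,1\}^{l-1}$ and edge set $\{0,1\}^l$, where the edge $b_0b_1\cdots b_{l-1}$ goes from the vertex $b_0b_1\cdots b_{l-2}$ to the vertex $b_1b_2\cdots b_{l-1}$. An edge is red if its last bit is $0$ and blue if its last bit is $1$; a subgraph (circuit, cycle) is balanced if it contains equally many red and blue edges. A circuit of length $n$ is a closed directed walk of $n$ edges, with no edge repeated, beginning and ending at the same vertex; a cycle is a circuit in which no vertex other than the initial/final one is repeated. -}

module Defs where

open import Data.Bool using (Bool; true; false; T)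
open import Data.Nat using (ℕ; zero; suc; _∸_)
open import Data.Vec using (Vec; []; _∷_; init; tail; last)
open import Data.List using (List; []; _∷_; length; map; filter)
open import Data.List.Relation.Unary.Unique.Propositional using (Unique)
open import Relation.Binary.PropositionalEquality using (_≡_)
open import Data.Bool.Properties using (T?)
open import Relation.Nullary.Decidable using (¬?)
open import Data.Empty using (⊥)
open import Data.Product using (_×_)

-- de Bruijn graph G_l (used for l ≥ 2): vertices {0,1}^(l-1), edges {0,1}^l
-- (bits represented by Bool: false = 0, true = 1)
Vertex : ℕ → Set
Vertex l = Vec Bool (l ∸ 1)

Edge : ℕ → Set
Edge l = Vec Bool l

-- edge b0 b1 ... b(l-1) goes from b0...b(l-2) to b1...b(l-1)
-- (the l = 0 clauses are junk and never used, since l ≥ 2)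
source : ∀ {l} → Edge l → Vertex l
source {zero} e = []
source {suc l} e = init e

target : ∀ {l} → Edge l → Vertex l
target {zero} e = []
target {suc l} e = tail e

isBlue : ∀ {l} → Edge l → Bool
isBlue {zero} e = false
isBlue {suc l} e = last e

#blue : ∀ {l} → List (Edge l) → ℕ
#blue es = length (filter (λ e → T? (isBlue e)) es)

#red : ∀ {l} → List (Edge l) → ℕ
#red es = length (filter (λ e → ¬? (T? (isBlue e))) es)

Balanced : ∀ {l} → List (Edge l) → Set
Balanced es = #red es ≡ #blue es

data Chain {l : ℕ} : List (Edge l) → Set where
  chain-[] : Chain []
  chain-[-] : ∀ e → Chain (e ∷ [])
  chain-∷ : ∀ e f es → target e ≡ source f → Chain (f ∷ es) → Chain (e ∷ f ∷ es)

lastEdge : ∀ {l} → Edge l → List (Edge l) → Edge l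
lastEdge e [] = e
lastEdge e (f ∷ es) = lastEdge f es

ClosedWalk : ∀ {l} → List (Edge l) → Set
ClosedWalk [] = ⊥
ClosedWalk (e ∷ es) = Chain (e ∷ es) × (target (lastEdge e es) ≡ source e)

Circuit : ∀ {l} → List (Edge l) → Set
Circuit es = ClosedWalk es × Unique es

-- cycle: circuit in which no vertex other than the initial/final one is
-- repeated, i.e. the visited vertices v_0, ..., v_(n-1) (the sources of the
-- edges) are pairwise distinct
Cycle : ∀ {l} → List (Edge l) → Set
Cycle es = Circuit es × Unique (map source es)

{-# OPTIONS --safe #-}
module Submission where

open import Defs
open import Function using (_∘_)
open import Data.Bool using (true; false)
open import Data.Nat using (ℕ; suc; _≤_)
open import Data.Vec using (_∷_; head)
open import Data.List using (List; []; _∷_; length; map; filter; _∷ʳ_)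
open import Data.List.Relation.Unary.Unique.Propositional using (Unique)
open import Data.List.Relation.Unary.Unique.Propositional.Properties using (map⁻)
open import Data.List.Relation.Binary.Permutation.Propositional using (_↭_; ↭-reflexive; ↭-sym; ↭-trans)
open import Data.List.Relation.Binary.Permutation.Propositional.Properties using (↭-length; filter-↭; ∷↭∷ʳ)
open import Data.Product using (Σ; _×_; _,_)
open import Data.Bool.Properties using (T?)
open import Relation.Nullary.Decidable using (does; ¬?)
open import Relation.Unary using (Pred; Decidable)
open import Relation.Binary.PropositionalEquality using (_≡_; refl; cong; cong₂; sym; trans; subst)
open Relation.Binary.PropositionalEquality.≡-Reasoning

-- A balanced circuit e₁ … eₙ of G_l lifts to the closed walk of G_(l+1) whose
-- i-th edge is eᵢ extended by the last bit of eᵢ₊₁ (indices mod n). Its vertices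
-- are the edges eᵢ, pairwise distinct because a circuit repeats no edge, so the
-- lift is a cycle; its colours are those of e₂ … eₙ e₁, a rotation, so it is
-- still balanced.

length-filter-map : ∀ {a b p} {A : Set a} {B : Set b} {P : Pred B p}
  (P? : Decidable P) (f : A → B) (xs : List A) →
  length (filter (P? ∘ f) xs) ≡ length (filter P? (map f xs))
length-filter-map P? f [] = refl
length-filter-map P? f (x ∷ xs) with does (P? (f x))
... | false = length-filter-map P? f xs
... | true  = cong suc (length-filter-map P? f xs)

balanced-↭-colours : ∀ {l l′} {xs : List (Edge l)} {ys : List (Edge l′)} →
  map isBlue xs ↭ map isBlue ys → Balanced xs → Balanced ys
balanced-↭-colours {xs = xs} {ys} p balanced = begin
  #red ys                                   ≡⟨ length-filter-map (¬? ∘ T?) isBlue ys ⟩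
  length (filter (¬? ∘ T?) (map isBlue ys)) ≡⟨ ↭-length (filter-↭ (¬? ∘ T?) (↭-sym p)) ⟩
  length (filter (¬? ∘ T?) (map isBlue xs)) ≡⟨ length-filter-map (¬? ∘ T?) isBlue xs ⟨
  #red xs                                   ≡⟨ balanced ⟩
  #blue xs                                  ≡⟨ length-filter-map T? isBlue xs ⟩
  length (filter T? (map isBlue xs))        ≡⟨ ↭-length (filter-↭ T? p) ⟩
  length (filter T? (map isBlue ys))        ≡⟨ length-filter-map T? isBlue ys ⟨
  #blue ys                                  ∎

module _ {m : ℕ} where

  extend : Edge (suc m) → Edge (suc m) → Edge (suc (suc m))
  extend e f = head e ∷ f

  source-extend : (e f : Edge (suc m)) → target e ≡ source f → source (extend e f) ≡ e
  source-extend (b ∷ e) f e≡f = cong (b ∷_) (sym e≡f)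

  -- lift e es s: the lift of the walk e ∷ es followed by the edge s
  lift : Edge (suc m) → List (Edge (suc m)) → Edge (suc m) → List (Edge (suc (suc m)))
  lift e []       s = extend e s ∷ []
  lift e (f ∷ es) s = extend e f ∷ lift f es s

  length-lift : ∀ e es s → length (lift e es s) ≡ length (e ∷ es)
  length-lift e []       s = refl
  length-lift e (f ∷ es) s = cong suc (length-lift f es s)

  colours-lift : ∀ e es s → map isBlue (lift e es s) ≡ map isBlue es ∷ʳ isBlue s
  colours-lift e []       s = refl
  colours-lift e (f ∷ es) s = cong (isBlue f ∷_) (colours-lift f es s)

  sources-lift : ∀ e es s → Chain (e ∷ es) → target (lastEdge e es) ≡ source s →
    map source (lift e es s) ≡ e ∷ es
  sources-lift e []       s _                        end = cong (_∷ []) (source-extend e s end)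
  sources-lift e (f ∷ es) s (chain-∷ _ _ _ e≡f chain) end =
    cong₂ _∷_ (source-extend e f e≡f) (sources-lift f es s chain end)

  target-lastEdge-lift : ∀ x e es s → target (lastEdge x (lift e es s)) ≡ s
  target-lastEdge-lift x e []       s = refl
  target-lastEdge-lift x e (f ∷ es) s = target-lastEdge-lift (extend e f) f es s

  chain-∷-lift : ∀ x e es s → target x ≡ e → Chain (e ∷ es) → target (lastEdge e es) ≡ source s →
    Chain (x ∷ lift e es s)
  chain-∷-lift x e []       s x≡e _ end =
    chain-∷ x _ [] (trans x≡e (sym (source-extend e s end))) (chain-[-] _)
  chain-∷-lift x e (f ∷ es) s x≡e (chain-∷ _ _ _ e≡f chain) end =
    chain-∷ x _ _ (trans x≡e (sym (source-extend e f e≡f))) (chain-∷-lift (extend e f) f es s refl chain end)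

  closedWalk-lift : ∀ e es → ClosedWalk (e ∷ es) → ClosedWalk (lift e es e)
  closedWalk-lift e []       (_ , closed) = chain-[-] _ , sym (source-extend e e closed)
  closedWalk-lift e (f ∷ es) (chain-∷ _ _ _ e≡f chain , closed) =
    chain-∷-lift (extend e f) f es e refl chain closed ,
    trans (target-lastEdge-lift (extend e f) f es e) (sym (source-extend e f e≡f))

  cycle-lift : ∀ e es → Circuit (e ∷ es) → Cycle (lift e es e)
  cycle-lift e es (walk@(chain , closed) , unique) =
    (closedWalk-lift e es walk , map⁻ uniqueSources) , uniqueSources
    where
    uniqueSources : Unique (map source (lift e es e))
    uniqueSources = subst Unique (sym (sources-lift e es e chain closed)) unique

  balanced-lift : ∀ e es → Balanced (e ∷ es) → Balanced (lift e es e)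
  balanced-lift e es = balanced-↭-colours (↭-trans (∷↭∷ʳ (isBlue e) (map isBlue es))
                                                   (↭-reflexive (sym (colours-lift e es e))))

lemma5 : (l n : ℕ) → 2 ≤ l → 1 ≤ n →
    Σ (List (Edge l)) (λ c → Circuit c × Balanced c × length c ≡ n) →
    Σ (List (Edge (suc l))) (λ c → Cycle c × Balanced c × length c ≡ n)
lemma5 (suc l) _ _ _ (e ∷ es , circuit , balanced , refl) =
  lift e es e , cycle-lift e es circuit , balanced-lift e es balanced , length-lift e es e
lemma5 (suc l) _ _ _ ([] , (() , _) , _)
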